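{- Let $\mathcal{P}=\langle P,A,I,G\rangle$ be a temporal planning problem and fix $\epsilon\ge0$. Let $\mathcal{N}$ be the network of timed automata encoding $\mathcal{P}$, and let $\pi$ be a plan with $\mathit{valid}(\pi)$ and $\mathit{no\_self\_overlap}(\pi)$, witnessed by a valid state sequence $[M_0,\dots,M_m]$ with $M_0=I$. Then there exist a configuration $C_0=\langle L_0,v_0,c_0\rangle$ and a finite run of $\mathcal{N}$ from the initial configuration to $C_0$ such that $\mathit{encodes\_after}(0,C_0)$ holds.
   Context: **Temporal planning.** A snap action $h=\langle\mathit{pres}(h),\mathit{adds}(h),\mathit{dels}(h)\rangle$ consists of three subsets of a finite set of propositions $P$. A durative action $a$ consists of: - start and end snap actions $a_\vdash$ and $a_\dashv$; - a set $\mathit{over\_all}(a)\subseteq P$ of invariants; - a lower bound $L(a)=\langle l_a,\triangleleft_1\rangle$ and an upper bound $U(a)=\langle\triangleleft_2,u_a\rangle$, with $l_a,u_a\in\mathbb{Q}$ and $\triangleleft_1,\triangleleft_2\in\{<,\le\}$. $\mathit{dur\_c\_sat}(a,d)$ holds iff $l_a\triangleleft_1 d$ and $d\triangleleft_2 u_a$. A problem $\mathcal{P}=\langle P,A,I,G\rangle$ consists of finite $P$, actions $A=\{a_1,\dots,a_N\}$, and $I,G\subseteq P$. **Plans.** A plan $\pi=[\langle\alpha_1,t_1,d_1\rangle,\dots,\langle\alpha_n,t_n,d_n\rangle]$ has $\alpha_i\in A$ and $t_i,d_i\in\mathbb{Q}$. - $H(\pi)$ is the set of pairs $\langle t_i,(\alpha_i)_\vdash\rangle$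 and $\langle t_i+d_i,(\alpha_i)_\dashv\rangle$. - $\mathit{htps}(\pi)=\{\tau_0<\dots<\tau_k\}$ is the set of time points occurring in $H(\pi)$, in increasing order. - $\mathit{Adds}(t)$ and $\mathit{Dels}(t)$ are the unions of $\mathit{adds}(h)$ and $\mathit{dels}(h)$ over $\langle t,h\rangle\in H(\pi)$. - $\mathit{Invs}(t)$ is the union of $\mathit{over\_all}(a)$ over $\langle a,t',d\rangle\in\pi$ with $t'<t\le t'+d$. $[M_0,\dots,M_m]$ is a valid state sequence if for each $\tau_i\in\mathit{htps}(\pi)$: - $\mathit{pres}(h)\subseteq M_i$ for every $\langle\tau_i,h\rangle\in H(\pi)$; - $M_{i+1}=(M_i\setminus\mathit{Dels}(\tau_i))\cup\mathit{Adds}(\tau_i)$; - $\mathit{Invs}(\tau_i)\subseteq M_i$. $\mathrm{mutex}(a,b)$ holds iff $\mathit{pres}(a)\cap(\mathit{adds}(b)\cup\mathit{dels}(b))\neq\emptyset$ or $\mathit{adds}(a)\cap\mathit{dels}(b)\ne\emptyset$. $\mathit{valid}(\pi)$ holds iff all of the following hold: 1. There is a valid state sequence with $M_0=I$ and $G\subseteq M_m$. 2. $\mathit{dur\_c\_sat}(\alpha_i,d_i)$ and $d_i\ge0$ hold for all $i$. 3. For $\langle s,a\rangle,\langle t,b\rangle\in H(\pi)$ with $a\ne b$ and $\mathrm{mutex}(a,b)$: $0<|t-s|$ and $\epsilon\le|t-s|$. $\mathit{no\_self\_overlap}(\pi)$ holds iff distinct entries $i,j$ with $t_i\le t_j\le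 t_i+d_i$ have $\alpha_i\ne\alpha_j$. **Networks of timed automata.** Automata have: - locations, an initial location, and urgent locations; - shared rational clocks and integer variables; - edges $\langle l,b,g,u,r,l'\rangle$ with a variable condition $b$, a clock guard $g$, variable updates $u$, and clock resets $r$. A configuration $\langle L,v,c\rangle$ consists of a location list, a variable assignment and a clock valuation. There are two kinds of transitions: - A delay by $\delta\ge0$, which adds $\delta$ to all clocks and is allowed only if no current location is urgent. - An internal transition of one automaton along an enabled edge: its current location matches $l$, $v\models b$ and $c\models g$. It moves that automaton to $l'$, applies the updates simultaneously, and resets the clocks in $r$ to $0$. A run is a finite sequence of transitions. **Encoding $\mathcal{N}$.** Variables are $vp_p$ and $lp_p$ ($p\in P$), $aa$ and $ps$. Clocks are $ca_\vdash$ and $ca_\dashv$ ($a\in A$); for a snap action $h$, $ch$ is $ca_\vdash$ if $h=a_\vdash$ and $ca_\dashv$ if $h=a_\dashv$. *Main automaton $\mathcal{A}_M$.* Locations $\mathit{init}_M$ (initial, urgent), $\mathit{plan}_M$ and $\mathit{goal}_M$. Edges: - $e_{1M}$ from $\mathit{init}_M$ to $\mathit{plan}_M$: unconditional; updates $ps:=1$ and $vp_p:=1$ for $p\in I$. - $e_{2M}$ from $\mathit{plan}_M$ to $\mathit{goal}_M$: condition $aa=0\wedge\bigwedge_{p\in G}vp_p=1$; update $ps:=2$. - A self-loop at $\mathit{goal}_M$. *Auxiliary formulas.* - $\mathit{mutex\_guards}(b)$: the guards $0<ch$ and $\epsilon\le ch$ for all snap actions $h$ with $\mathrm{mutex}(b,h)$.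 - $\mathit{pre\_sat}(b)$: $\bigwedge_{p\in\mathit{pres}(b)}vp_p=1$. - $\mathit{eff\_sat\_invs}(b)$: $\bigwedge_{p\in\mathit{dels}(b)\setminus\mathit{adds}(b)}lp_p=0$. - $\mathit{prop\_effs}(b)$: $vp_p:=0$ for $p\in\mathit{dels}(b)\setminus\mathit{adds}(b)$, and $vp_p:=1$ for $p\in\mathit{adds}(b)$. - $\mathit{sat\_dur\_bounds}(a)$: $\{l_a\triangleleft_1ca_\vdash,\ ca_\vdash\triangleleft_2u_a\}$. *Action automaton $\mathcal{A}_a$.* Locations $\mathit{inactive}$ (initial), $\mathit{starting}$ (urgent), $\mathit{running}$ and $\mathit{ending}$ (urgent). All edges are additionally conditioned on $ps=1$: - $se_a$ from $\mathit{inactive}$ to $\mathit{starting}$: condition $\mathit{pre\_sat}(a_\vdash)\wedge\mathit{eff\_sat\_invs}(a_\vdash)$; guard $\mathit{mutex\_guards}(a_\vdash)$; updates $\mathit{prop\_effs}(a_\vdash)$ and $aa:=aa+1$; reset $ca_\vdash$. - $se'_a$ from $\mathit{starting}$ to $\mathit{running}$: condition $vp_p=1$ for $p\in\mathit{over\_all}(a)$; updates $lp_p:=lp_p+1$ for those $p$. - $ee_a$ from $\mathit{running}$ to $\mathit{ending}$: guard $\mathit{mutex\_guards}(a_\vdash)\cup\mathit{sat\_dur\_bounds}(a)$; updates $lp_p:=lp_p-1$ for $p\in\mathit{over\_all}(a)$; reset $ca_\dashv$. - $ee'_a$ from $\mathit{ending}$ to $\mathit{inactive}$: condition $\mathit{pre\_sat}(a_\dashv)\wedge\mathit{eff\_sat\_invs}(a_\dashv)$;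 updates $\mathit{prop\_effs}(a_\dashv)$ and $aa:=aa-1$. - $ie_a$ from $\mathit{starting}$ to $\mathit{ending}$: guard $\mathit{mutex\_guards}(a_\dashv)\cup\mathit{sat\_dur\_bounds}(a)$; reset $ca_\dashv$. *Network and initial configuration.* $\mathcal{N}=[\mathcal{A}_M,\mathcal{A}_{a_1},\dots,\mathcal{A}_{a_N}]$. The initial configuration has locations $[\mathit{init}_M,\mathit{inactive},\dots]$ and all variables and clocks equal to $0$. **Encoded state.** - $\mathit{running\_after}(a,\tau)$ holds iff there are $s,d$ with $\langle a,s,d\rangle\in\pi$, $s\le\tau$ and $\neg(s+d\le\tau)$. - $\mathit{time\_since\_after}(h,\tau)=\tau-s$, where $s$ is the greatest time with $\langle s,h\rangle\in H(\pi)$ and $s\le\tau$. If no such $s$ exists, it is $\tau+d$ for some (arbitrary) $d>0$. For a configuration $C=\langle L,v,c\rangle$, $\mathit{encodes\_after}(i,C)$ is defined as follows. If $\mathit{htps}(\pi)$ is nonempty, it holds iff: - for every $a_j\in A$: $L$ records $\mathcal{A}_{a_j}$ at $\mathit{running}$ if $\mathit{running\_after}(a_j,\tau_i)$ and at $\mathit{inactive}$ otherwise, and $c(ca_{j\vdash})$, $c(ca_{j\dashv})$ equal $\mathit{time\_since\_after}$ of $a_{j\vdash}$, $a_{j\dashv}$ at $\tau_i$; - for every $p\in P$: $v(vp_p)=1$ if $p\in M_{i+1}$ and $0$ otherwise, and $v(lp_p)=|\{a: p\in\mathit{over\_all}(a),\ \mathit{running\_after}(a,\tau_i)\}|$. If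 $\mathit{htps}(\pi)$ is empty, it holds iff: - every $\mathcal{A}_{a_j}$ is at $\mathit{inactive}$ and all clocks $ca_{j\vdash},ca_{j\dashv}$ are $>0$; - $v(vp_p)=1$ iff $p\in I$ (else $0$), and $v(lp_p)=0$ for all $p\in P$. -}

module Defs where

open import Data.Nat using (ℕ; zero; suc)
open import Data.Integer as ℤ using (ℤ; +_)
open import Data.Rational using (ℚ; 0ℚ; _+_; _-_; _<_; _≤_; ∣_∣)
open import Data.Rational.Properties using (_≤?_)
open import Data.Fin using (Fin; zero; suc)
open import Data.Fin.Properties using () renaming (_≟_ to _≟ᶠ_)
open import Data.Fin.Subset using (Subset; _∈_; _∉_; _∩_; _∪_; _⊆_; Nonempty)
open import Data.Fin.Subset.Properties using (_∈?_)
open import Data.List using (List; []; _∷_; length; filter; allFin; lookup)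
open import Data.List.Membership.Propositional using () renaming (_∈_ to _∈ˡ_)
open import Data.List.Relation.Unary.Any using (Any; any?)
open import Data.List.Relation.Unary.Linked using (Linked)
open import Data.Maybe using (Maybe; just; nothing)
open import Data.Product using (Σ; ∃; ∃-syntax; _×_; _,_)
open import Data.Sum using (_⊎_)
open import Data.Unit using (⊤)
open import Data.Product.Properties using (≡-dec)
open import Data.Bool using (Bool; true; false; if_then_else_)
open import Relation.Nullary using (¬_; Dec; does; yes; no)
open import Relation.Nullary.Decidable using (_×-dec_; ¬?)
open import Relation.Binary.PropositionalEquality using (_≡_; _≢_; refl)
open import Function.Bundles using (_⇔_)
open import Relation.Binary.Construct.Closure.ReflexiveTransitive using (Star)

data Strictness : Set where
  lt le : Strictness

_⊲[_]_ : ℚ → Strictness → ℚ → Set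
x ⊲[ lt ] y = x < y
x ⊲[ le ] y = x ≤ y

record SnapAction (nP : ℕ) : Set where
  field
    pres adds dels : Subset nP

record DurAction (nP : ℕ) : Set where
  field
    start end : SnapAction nP
    overAll   : Subset nP
    lower     : ℚ
    lowerS    : Strictness
    upperS    : Strictness
    upper     : ℚ

dur-c-sat : ∀ {nP} → DurAction nP → ℚ → Set
dur-c-sat a d = (DurAction.lower a ⊲[ DurAction.lowerS a ] d)
              × (d ⊲[ DurAction.upperS a ] DurAction.upper a)

record Problem (nP nA : ℕ) : Set where
  field
    act  : Fin nA → DurAction nP
    init : Subset nP
    goal : Subset nP

data Side : Set where
  start end : Side

SnapId : ℕ → Set
SnapId nA = Fin nA × Side

_≟ˢ_ : (x y : Side) → Dec (x ≡ y)
start ≟ˢ start = yes refl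
start ≟ˢ end   = no (λ ())
end   ≟ˢ start = no (λ ())
end   ≟ˢ end   = yes refl

_≟ᶜ_ : ∀ {nA} (x y : SnapId nA) → Dec (x ≡ y)
_≟ᶜ_ = ≡-dec _≟ᶠ_ _≟ˢ_

module _ {nP nA : ℕ} (Pr : Problem nP nA) where
  open Problem Pr

  snap : SnapId nA → SnapAction nP
  snap (a , start) = DurAction.start (act a)
  snap (a , end)   = DurAction.end (act a)

mutex : ∀ {nP} → SnapAction nP → SnapAction nP → Set
mutex a b = Nonempty (SnapAction.pres a ∩ (SnapAction.adds b ∪ SnapAction.dels b))
          ⊎ Nonempty (SnapAction.adds a ∩ SnapAction.dels b)

-- a plan: list of ⟨α_i, t_i, d_i⟩
Plan : ℕ → Set
Plan nA = List (Fin nA × ℚ × ℚ)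

InH : ∀ {nA} → Plan nA → ℚ → SnapId nA → Set
InH π t h = ∃[ α ] ∃[ s ] ∃[ d ] ((α , s , d) ∈ˡ π
            × ((h ≡ (α , start) × t ≡ s) ⊎ (h ≡ (α , end) × t ≡ s + d)))

Happening : ∀ {nA} → Plan nA → ℚ → Set
Happening π t = ∃[ h ] InH π t h

IsHtps : ∀ {nA} → Plan nA → List ℚ → Set
IsHtps π τs = Linked _<_ τs × (∀ t → (t ∈ˡ τs) ⇔ Happening π t)

nth : {A : Set} → List A → ℕ → Maybe A
nth []       _       = nothing
nth (x ∷ xs) zero    = just x
nth (x ∷ xs) (suc i) = nth xs i

module _ {nP nA : ℕ} (Pr : Problem nP nA) where
  open Problem Pr

  InAdds : Plan nA → ℚ → Fin nP → Set
  InAdds π t p = ∃[ h ] (InH π t h × p ∈ SnapAction.adds (snap Pr h))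

  InDels : Plan nA → ℚ → Fin nP → Set
  InDels π t p = ∃[ h ] (InH π t h × p ∈ SnapAction.dels (snap Pr h))

  InInvs : Plan nA → ℚ → Fin nP → Set
  InInvs π t p = ∃[ α ] ∃[ s ] ∃[ d ] ((α , s , d) ∈ˡ π × s < t × t ≤ s + d
                 × p ∈ DurAction.overAll (act α))

  ValidStateSeq : Plan nA → List ℚ → (ℕ → Subset nP) → Set
  ValidStateSeq π τs M = ∀ i τ → nth τs i ≡ just τ →
      (∀ h → InH π τ h → SnapAction.pres (snap Pr h) ⊆ M i)
    × (∀ p → (p ∈ M (suc i)) ⇔ ((p ∈ M i × ¬ InDels π τ p) ⊎ InAdds π τ p))
    × (∀ p → InInvs π τ p → p ∈ M i)

  record Valid (ε : ℚ) (π : Plan nA) (τs : List ℚ) : Set where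
    field
      states : ∃[ M ] (ValidStateSeq π τs M × M 0 ≡ init × goal ⊆ M (length τs))
      durs   : ∀ α t d → (α , t , d) ∈ˡ π → dur-c-sat (act α) d × 0ℚ ≤ d
      mutexSep : ∀ s t a b → InH π s a → InH π t b → a ≢ b →
                 mutex (snap Pr a) (snap Pr b) →
                 0ℚ < ∣ t - s ∣ × ε ≤ ∣ t - s ∣

NoSelfOverlap : ∀ {nA} → Plan nA → Set
NoSelfOverlap π = ∀ i j → i ≢ j →
  let (αi , ti , di) = lookup π i
      (αj , tj , dj) = lookup π j
  in ti ≤ tj → tj ≤ ti + di → αi ≢ αj

record TA (V C : Set) : Set₁ where
  field
    Loc     : Set
    initLoc : Loc
    urgent  : Loc → Set
    Edge    : Set
    src tgt : Edge → Loc
    cond    : Edge → (V → ℤ) → Set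
    guard   : Edge → (C → ℚ) → Set
    update  : Edge → (V → ℤ) → (V → ℤ)
    resets  : Edge → C → Bool

module _ {V C : Set} {k : ℕ} (N : Fin k → TA V C) where

  record Config : Set where
    constructor ⟨_,_,_⟩
    field
      L : (i : Fin k) → TA.Loc (N i)
      v : V → ℤ
      c : C → ℚ

  data Step : Config → Config → Set where
    delay : ∀ {L v c} (δ : ℚ) → 0ℚ ≤ δ → (∀ i → ¬ TA.urgent (N i) (L i)) →
            Step ⟨ L , v , c ⟩ ⟨ L , v , (λ x → c x + δ) ⟩
    internal : ∀ {L L' v c} (i : Fin k) (e : TA.Edge (N i)) →
            TA.src (N i) e ≡ L i → TA.cond (N i) e v → TA.guard (N i) e c →
            L' i ≡ TA.tgt (N i) e → (∀ j → j ≢ i → L' j ≡ L j) →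
            Step ⟨ L , v , c ⟩
                 ⟨ L' , TA.update (N i) e v
                      , (λ x → if TA.resets (N i) e x then 0ℚ else c x) ⟩

  Run : Config → Config → Set
  Run = Star Step

  initConfig : Config
  initConfig = ⟨ (λ i → TA.initLoc (N i)) , (λ _ → + 0) , (λ _ → 0ℚ) ⟩

data Var (nP : ℕ) : Set where
  vp lp : Fin nP → Var nP
  aa ps : Var nP

data MLoc : Set where
  initM planM goalM : MLoc

data MUrgent : MLoc → Set where
  initM-urgent : MUrgent initM

data MEdge : Set where
  e1M e2M loopM : MEdge

data ALoc : Set where
  inactive starting running ending : ALoc

data AUrgent : ALoc → Set where
  starting-urgent : AUrgent starting
  ending-urgent   : AUrgent ending

data AEdge : Set where
  se se' ee ee' ie : AEdge

module Encoding {nP nA : ℕ} (Pr : Problem nP nA) (ε : ℚ) where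
  open Problem Pr

  Clock : Set
  Clock = SnapId nA

  mainTA : TA (Var nP) Clock
  mainTA = record
    { Loc = MLoc ; initLoc = initM ; urgent = MUrgent ; Edge = MEdge
    ; src = λ { e1M → initM ; e2M → planM ; loopM → goalM }
    ; tgt = λ { e1M → planM ; e2M → goalM ; loopM → goalM }
    ; cond = λ { e1M v → ⊤ ; e2M v → v aa ≡ + 0 × (∀ p → p ∈ goal → v (vp p) ≡ + 1)
               ; loopM v → ⊤ }
    ; guard = λ _ _ → ⊤
    ; update = upd
    ; resets = λ _ _ → false
    }
    where
      upd : MEdge → (Var nP → ℤ) → (Var nP → ℤ)
      upd e1M v (vp p) = if does (p ∈? init) then + 1 else v (vp p)
      upd e1M v (lp p) = v (lp p)
      upd e1M v aa     = v aa
      upd e1M v ps     = + 1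
      upd e2M v ps     = + 2
      upd e2M v x      = v x
      upd loopM v x    = v x

  mutex-guards : Clock → (Clock → ℚ) → Set
  mutex-guards b c = ∀ h → mutex (snap Pr b) (snap Pr h) → 0ℚ < c h × ε ≤ c h

  pre-sat : Clock → (Var nP → ℤ) → Set
  pre-sat b v = ∀ p → p ∈ SnapAction.pres (snap Pr b) → v (vp p) ≡ + 1

  eff-sat-invs : Clock → (Var nP → ℤ) → Set
  eff-sat-invs b v = ∀ p → p ∈ SnapAction.dels (snap Pr b) →
                     p ∉ SnapAction.adds (snap Pr b) → v (lp p) ≡ + 0

  -- prop_effs(b) together with aa := aa + δ
  prop-effs : Clock → ℤ → (Var nP → ℤ) → (Var nP → ℤ)
  prop-effs b δ v (vp p) =
    if does (p ∈? SnapAction.adds (snap Pr b)) then + 1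
    else if does (p ∈? SnapAction.dels (snap Pr b)) then + 0
    else v (vp p)
  prop-effs b δ v (lp p) = v (lp p)
  prop-effs b δ v aa     = v aa ℤ.+ δ
  prop-effs b δ v ps     = v ps

  sat-dur-bounds : Fin nA → (Clock → ℚ) → Set
  sat-dur-bounds a c = dur-c-sat (act a) (c (a , start))

  lp-shift : Fin nA → ℤ → (Var nP → ℤ) → (Var nP → ℤ)
  lp-shift a δ v (lp p) = if does (p ∈? DurAction.overAll (act a))
                          then v (lp p) ℤ.+ δ else v (lp p)
  lp-shift a δ v x      = v x

  actionTA : Fin nA → TA (Var nP) Clock
  actionTA a = record
    { Loc = ALoc ; initLoc = inactive ; urgent = AUrgent ; Edge = AEdge
    ; src = λ { se → inactive ; se' → starting ; ee → running ; ee' → ending ; ie → starting }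
    ; tgt = λ { se → starting ; se' → running ; ee → ending ; ee' → inactive ; ie → ending }
    ; cond = λ e v → v ps ≡ + 1 × cnd e v
    ; guard = grd
    ; update = upd
    ; resets = rst
    }
    where
      a⊢ a⊣ : Clock
      a⊢ = (a , start)
      a⊣ = (a , end)
      cnd : AEdge → (Var nP → ℤ) → Set
      cnd se  v = pre-sat a⊢ v × eff-sat-invs a⊢ v
      cnd se' v = ∀ p → p ∈ DurAction.overAll (act a) → v (vp p) ≡ + 1
      cnd ee  v = ⊤
      cnd ee' v = pre-sat a⊣ v × eff-sat-invs a⊣ v
      cnd ie  v = ⊤
      grd : AEdge → (Clock → ℚ) → Set
      grd se  c = mutex-guards a⊢ c
      grd se' c = ⊤
      grd ee  c = mutex-guards a⊢ c × sat-dur-bounds a c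
      grd ee' c = ⊤
      grd ie  c = mutex-guards a⊣ c × sat-dur-bounds a c
      upd : AEdge → (Var nP → ℤ) → (Var nP → ℤ)
      upd se  v = prop-effs a⊢ (+ 1) v
      upd se' v = lp-shift a (+ 1) v
      upd ee  v = lp-shift a (ℤ.- (+ 1)) v
      upd ee' v = prop-effs a⊣ (ℤ.- (+ 1)) v
      upd ie  v = v
      rst : AEdge → Clock → Bool
      rst se  x = does (x ≟ᶜ a⊢)
      rst ee  x = does (x ≟ᶜ a⊣)
      rst ie  x = does (x ≟ᶜ a⊣)
      rst _   x = false

  net : Fin (suc nA) → TA (Var nP) Clock
  net zero    = mainTA
  net (suc a) = actionTA a

module Encoded {nP nA : ℕ} (Pr : Problem nP nA) (ε : ℚ) where
  open Problem Pr
  open Encoding Pr ε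

  RunningAfter : Plan nA → Fin nA → ℚ → Set
  RunningAfter π a τ = Any (λ { (α , s , d) → α ≡ a × s ≤ τ × ¬ (s + d ≤ τ) }) π

  running-after? : (π : Plan nA) (a : Fin nA) (τ : ℚ) → Dec (RunningAfter π a τ)
  running-after? π a τ =
    any? (λ { (α , s , d) → (α ≟ᶠ a) ×-dec ((s ≤? τ) ×-dec ¬? ((s + d) ≤? τ)) }) π

  lp-count : Plan nA → ℚ → Fin nP → ℕ
  lp-count π τ p = length (filter (λ a → (p ∈? DurAction.overAll (act a))
                                         ×-dec running-after? π a τ) (allFin nA))

  TimeSinceAfter : Plan nA → SnapId nA → ℚ → ℚ → Set
  TimeSinceAfter π h τ x =
      (∃[ s ] (InH π s h × s ≤ τ × (∀ s' → InH π s' h → s' ≤ τ → s' ≤ s) × x ≡ τ - s))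
    ⊎ ((∀ s → InH π s h → ¬ (s ≤ τ)) × ∃[ d ] (0ℚ < d × x ≡ τ + d))

  Conf : Set
  Conf = Config net

  EncodesAfter : Plan nA → List ℚ → (ℕ → Subset nP) → ℕ → Conf → Set
  EncodesAfter π [] M i ⟨ L , v , c ⟩ =
      (∀ a → L (suc a) ≡ inactive × 0ℚ < c (a , start) × 0ℚ < c (a , end))
    × (∀ p → (p ∈ init → v (vp p) ≡ + 1) × (p ∉ init → v (vp p) ≡ + 0))
    × (∀ p → v (lp p) ≡ + 0)
  EncodesAfter π τs@(_ ∷ _) M i ⟨ L , v , c ⟩ = ∃[ τ ] (nth τs i ≡ just τ ×
      (∀ a → (RunningAfter π a τ → L (suc a) ≡ running)
           × (¬ RunningAfter π a τ → L (suc a) ≡ inactive)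
           × TimeSinceAfter π (a , start) τ (c (a , start))
           × TimeSinceAfter π (a , end) τ (c (a , end)))
    × (∀ p → (p ∈ M (suc i) → v (vp p) ≡ + 1) × (p ∉ M (suc i) → v (vp p) ≡ + 0))
    × (∀ p → v (lp p) ≡ + lp-count π τ p))

{-# OPTIONS --safe #-}
-- The run fires e₁ and then lets all clocks grow to a value δ exceeding τ₀ and ε, so that δ can
-- stand for "this snap action has not happened yet". The snap actions happening at τ₀ are pairwise
-- non-mutex (ε-separation would demand |τ₀ - τ₀| > 0), hence they can be fired one action automaton
-- at a time in any order: afterwards every proposition touched by a fired snap action carries its
-- value in M₁, every other one its value in M₀ (and the two agree on untouched propositions), and
-- a mutex guard only ever inspects clocks still equal to δ. Actions running after τ₀ take se;
-- actions starting and ending at τ₀ have duration 0 and take se, ie and ee' (no self-overlap rules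
-- out an action doing both). Only then do the running actions take se': eff_sat_invs needs lp = 0
-- while effects are applied, and their invariants hold in M₁ because they must hold at τ₁.
module Submission where

open import Defs
open import Data.Nat using (ℕ)
open import Data.Rational using (ℚ; 0ℚ; _≤_)
open import Data.Fin.Subset using (Subset)
open import Data.List using (List)
open import Data.Product using (∃-syntax; _×_)
open import Relation.Binary.PropositionalEquality using (_≡_)

open import Level using (0ℓ)
open import Data.Nat using (suc)
open import Data.Integer as ℤ using (ℤ; +_)
import Data.Integer.Properties as ℤP
open import Data.Rational using (_<_; _+_; -_; 1ℚ; _⊔_; ∣_∣)
open import Data.Rational.Properties
  using (≤-refl; ≤-reflexive; ≤-trans; ≤-antisym; <⇒≤; ≤-<-trans; <-trans; <-irrefl; ≰⇒>;
         _≤?_;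
         +-identityˡ; +-identityʳ; +-inverseˡ; +-inverseʳ; +-monoʳ-≤; +-monoʳ-<;
         p≤p⊔q; p≤q⊔p; positive⁻¹; +-0-group)
  renaming (_≟_ to _≟ℚ_)
open import Algebra.Properties.Group +-0-group using (identityʳ-unique; \\-leftDividesˡ)
open import Data.Fin using (Fin; zero; suc)
open import Data.Fin.Properties using () renaming (_≟_ to _≟ᶠ_)
open import Data.Fin.Subset using (_∈_; _∉_)
open import Data.Fin.Subset.Properties using (_∈?_; x∈p∩q⁺; x∈p∪q⁺)
open import Data.List using ([]; _∷_; length; filter; allFin; lookup)
open import Data.List.Membership.Propositional
  using (find; lose) renaming (_∈_ to _∈ˡ_; _∉_ to _∉ˡ_)
open import Data.List.Membership.Propositional.Properties using (∈-allFin)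
open import Data.List.Relation.Unary.Any as Any using (Any; here; there; any?)
open import Data.List.Relation.Unary.Any.Properties using (lookup-index)
open import Data.List.Relation.Unary.All as All using ()
open import Data.List.Relation.Unary.All.Properties using (All¬⇒¬Any)
open import Data.List.Relation.Unary.AllPairs as AllPairs using (_∷_)
open import Data.List.Relation.Unary.Linked using (Linked; [-]; _∷_)
open import Data.List.Relation.Unary.Linked.Properties using (Linked⇒AllPairs)
open import Data.List.Relation.Unary.Unique.Propositional using (Unique)
open import Data.List.Relation.Unary.Unique.Propositional.Properties using (allFin⁺)
open import Data.Maybe using (just)
open import Data.Product using (_,_; proj₁; proj₂)
open import Data.Sum using (_⊎_; inj₁; inj₂; [_,_])
open import Data.Empty using (⊥-elim)
open import Data.Unit using (tt)
open import Data.Bool using (if_then_else_)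
open import Function using (_∘_)
open import Function.Bundles using (_⇔_; mk⇔; Equivalence)
open import Relation.Nullary using (¬_; Dec; yes; no; does)
open import Relation.Nullary.Decidable
  using (decidable-stable; ¬¬-excluded-middle; _×-dec_; _⊎-dec_; map′)
open import Relation.Unary using (Pred; _⊆_; _∪_; _≐_; ｛_｝)
open import Relation.Binary.PropositionalEquality
  using (refl; sym; trans; cong; subst; subst₂; _≢_; module ≡-Reasoning)
open import Relation.Binary.Construct.Closure.ReflexiveTransitive
  using (Star; _◅_; _◅◅_) renaming (ε to [])

module _ {A C : Set} {R : C → C → Set} (Inv : List A → C → Set)
         (step : ∀ {x xs c} → x ∉ˡ xs → Inv (x ∷ xs) c → ∃[ c' ] (Star R c c' × Inv xs c'))
         where

  iterate-over-Unique : ∀ {xs c} → Unique xs → Inv xs c → ∃[ c' ] (Star R c c' × Inv [] c')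
  iterate-over-Unique {[]}     _          inv = _ , [] , inv
  iterate-over-Unique {x ∷ xs} (x∉ ∷ uniq) inv with step (All¬⇒¬Any x∉) inv
  ... | _ , run , inv′ with iterate-over-Unique uniq inv′
  ...   | c″ , run′ , inv″ = c″ , run ◅◅ run′ , inv″

sorted-head-≤ : ∀ {x y xs} → Linked _<_ (x ∷ xs) → y ∈ˡ x ∷ xs → x ≤ y
sorted-head-≤ _      (here refl) = ≤-refl
sorted-head-≤ sorted (there y∈)  =
  <⇒≤ (All.lookup (AllPairs.head (Linked⇒AllPairs <-trans sorted)) y∈)

sorted-next-≤ : ∀ {x y xs} → Linked _<_ (x ∷ xs) → y ∈ˡ x ∷ xs → x < y →
                ∃[ x₁ ] (nth xs 0 ≡ just x₁ × x < x₁ × x₁ ≤ y)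
sorted-next-≤ _               (here refl) x<x = ⊥-elim (<-irrefl refl x<x)
sorted-next-≤ [-]             (there ())  _
sorted-next-≤ (x<x₁ ∷ sorted) (there y∈)  _   = _ , refl , x<x₁ , sorted-head-≤ sorted y∈

p≤p+q : ∀ p {q} → 0ℚ ≤ q → p ≤ p + q
p≤p+q p 0≤q = subst (_≤ p + _) (+-identityʳ p) (+-monoʳ-≤ p 0≤q)

p<p+q : ∀ p {q} → 0ℚ < q → p < p + q
p<p+q p 0<q = subst (_< p + _) (+-identityʳ p) (+-monoʳ-< p 0<q)

0<1 : 0ℚ < 1ℚ
0<1 = positive⁻¹ 1ℚ

Indicates : ∀ {n} → ℤ → Subset n → Fin n → Set
Indicates z X p = (p ∈ X → z ≡ + 1) × (p ∉ X → z ≡ + 0)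

indicates-resp : ∀ {n z} {X Y : Subset n} {p} →
                 (p ∈ X ⇔ p ∈ Y) → Indicates z X p → Indicates z Y p
indicates-resp X⇔Y (inX , notX) = inX ∘ Equivalence.from X⇔Y , notX ∘ (_∘ Equivalence.to X⇔Y)

indicates-stable : ∀ {n z} {X : Subset n} {p} → ¬ ¬ Indicates z X p → Indicates z X p
indicates-stable {z = z} ¬¬ind =
    (λ p∈ → decidable-stable (z ℤ.≟ + 1) λ z≢1 → ¬¬ind λ ind → z≢1 (proj₁ ind p∈))
  , (λ p∉ → decidable-stable (z ℤ.≟ + 0) λ z≢0 → ¬¬ind λ ind → z≢0 (proj₂ ind p∉))

module _ {nA : ℕ} where

  start-happens : ∀ {π : Plan nA} {α s d} → (α , s , d) ∈ˡ π → InH π s (α , start)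
  start-happens e∈ = _ , _ , _ , e∈ , inj₁ (refl , refl)

  end-happens : ∀ {π : Plan nA} {α s d} → (α , s , d) ∈ˡ π → InH π (s + d) (α , end)
  end-happens e∈ = _ , _ , _ , e∈ , inj₂ (refl , refl)

  InH? : ∀ (π : Plan nA) t h → Dec (InH π t h)
  InH? π t h = map′ from-any to-any (any? happens-at? π)
    where
    HappensAt : Fin nA × ℚ × ℚ → Set
    HappensAt (α , s , d) = (h ≡ (α , start) × t ≡ s) ⊎ (h ≡ (α , end) × t ≡ s + d)

    happens-at? : ∀ e → Dec (HappensAt e)
    happens-at? (α , s , d) =
      ((h ≟ᶜ (α , start)) ×-dec (t ≟ℚ s)) ⊎-dec ((h ≟ᶜ (α , end)) ×-dec (t ≟ℚ (s + d)))

    from-any : Any HappensAt π → InH π t h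
    from-any happens with find happens
    ... | (α , s , d) , e∈ , at = α , s , d , e∈ , at

    to-any : InH π t h → Any HappensAt π
    to-any (_ , _ , _ , e∈ , at) = lose e∈ at

  no-self-overlap-∈ : ∀ {π : Plan nA} → NoSelfOverlap π → ∀ {α t₁ d₁ t₂ d₂} →
                      (α , t₁ , d₁) ∈ˡ π → (α , t₂ , d₂) ∈ˡ π → (t₁ , d₁) ≢ (t₂ , d₂) →
                      t₁ ≤ t₂ → ¬ (t₂ ≤ t₁ + d₁)
  no-self-overlap-∈ {π} nso {α} {t₁} {d₁} {t₂} {d₂} e₁ e₂ distinct t₁≤t₂ t₂≤end
    with Any.index e₁ ≟ᶠ Any.index e₂
  ... | yes same = distinct (cong proj₂ (begin
    (α , t₁ , d₁)            ≡⟨ lookup-index e₁ ⟩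
    lookup π (Any.index e₁)  ≡⟨ cong (lookup π) same ⟩
    lookup π (Any.index e₂)  ≡⟨ lookup-index e₂ ⟨
    (α , t₂ , d₂)            ∎))
    where open ≡-Reasoning
  ... | no differ = subst₂ SelfOverlapFree (sym (lookup-index e₁)) (sym (lookup-index e₂))
                           (nso _ _ differ) t₁≤t₂ t₂≤end refl
    where
    SelfOverlapFree : Fin nA × ℚ × ℚ → Fin nA × ℚ × ℚ → Set
    SelfOverlapFree (αi , ti , di) (αj , tj , dj) = ti ≤ tj → tj ≤ ti + di → αi ≢ αj

reset : ∀ {nA} → SnapId nA → (SnapId nA → ℚ) → SnapId nA → ℚ
reset h c x = if does (x ≟ᶜ h) then 0ℚ else c x

module Network {nP nA : ℕ} (Pr : Problem nP nA) (ε : ℚ) where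
  open Problem Pr
  open Encoding Pr ε

  Locs : Set
  Locs = (i : Fin (suc nA)) → TA.Loc (net i)

  _[_]≔_ : Locs → Fin nA → ALoc → Locs
  (L [ a ]≔ l) zero    = L zero
  (L [ a ]≔ l) (suc b) = if does (b ≟ᶠ a) then l else L (suc b)

  []≔-self : ∀ L a l → (L [ a ]≔ l) (suc a) ≡ l
  []≔-self L a l with a ≟ᶠ a
  ... | yes _   = refl
  ... | no a≢a = ⊥-elim (a≢a refl)

  []≔-other : ∀ L a l b → b ≢ a → (L [ a ]≔ l) (suc b) ≡ L (suc b)
  []≔-other L a l b b≢a with b ≟ᶠ a
  ... | yes b≡a = ⊥-elim (b≢a b≡a)
  ... | no _    = refl

  actionStep : ∀ {L v c} a (e : AEdge) →
               TA.src (actionTA a) e ≡ L (suc a) →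
               TA.cond (actionTA a) e v → TA.guard (actionTA a) e c →
               Step net ⟨ L , v , c ⟩
                        ⟨ L [ a ]≔ TA.tgt (actionTA a) e , TA.update (actionTA a) e v
                        , (λ x → if TA.resets (actionTA a) e x then 0ℚ else c x) ⟩
  actionStep {L} a e src cond guard = internal (suc a) e src cond guard ([]≔-self L a _) others
    where
    others : ∀ j → j ≢ suc a → (L [ a ]≔ TA.tgt (actionTA a) e) j ≡ L j
    others zero    _   = refl
    others (suc b) b≢a = []≔-other L a _ b (b≢a ∘ cong suc)

  record Located (before after : Fin nA → ALoc) (pending : List (Fin nA)) (L : Locs) : Set
    where
    field
      pending-at : ∀ {a} → a ∈ˡ pending → L (suc a) ≡ before a
      done-at    : ∀ {a} → a ∉ˡ pending → L (suc a) ≡ after a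

  located-step : ∀ {before after x xs L L'} → x ∉ˡ xs → Located before after (x ∷ xs) L →
                 (∀ a → a ≢ x → L' (suc a) ≡ L (suc a)) → L' (suc x) ≡ after x →
                 Located before after xs L'
  located-step {after = after} {x} {xs} {L' = L'} x∉ located unmoved moved = record
    { pending-at = λ a∈ → trans (unmoved _ (λ { refl → x∉ a∈ })) (pending-at (there a∈))
    ; done-at    = done-at′ }
    where
    open Located located
    done-at′ : ∀ {a} → a ∉ˡ xs → L' (suc a) ≡ after a
    done-at′ {a} a∉ with a ≟ᶠ x
    ... | yes refl = moved
    ... | no a≢x  =
      trans (unmoved a a≢x) (done-at λ { (here a≡x) → a≢x a≡x ; (there a∈) → a∉ a∈ })

  startLocs : Locs
  startLocs zero    = planM
  startLocs (suc a) = inactive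

  startVars : Var nP → ℤ
  startVars = TA.update mainTA e1M (λ _ → + 0)

  start-run : ∀ d → 0ℚ ≤ d →
              Run net (initConfig net) ⟨ startLocs , startVars , (λ _ → 0ℚ + d) ⟩
  start-run d 0≤d =
      internal zero e1M refl tt tt refl (λ { zero 0≢0 → ⊥-elim (0≢0 refl) ; (suc a) _ → refl })
    ◅ delay d 0≤d (λ { zero () ; (suc a) () })
    ◅ []

  startVars-indicate-init : ∀ p → Indicates (startVars (vp p)) init p
  startVars-indicate-init p with p ∈? init
  ... | yes p∈ = (λ _ → refl) , (λ p∉ → ⊥-elim (p∉ p∈))
  ... | no p∉  = (λ p∈ → ⊥-elim (p∉ p∈)) , (λ _ → refl)

  encoded-without-happenings : ∀ π M →
    ∃[ C₀ ] (Run net (initConfig net) C₀ × Encoded.EncodesAfter Pr ε π [] M 0 C₀)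
  encoded-without-happenings π M =
      _ , start-run 1ℚ (<⇒≤ 0<1)
    , (λ _ → refl , 0<0+1 , 0<0+1) , startVars-indicate-init , (λ _ → refl)
    where
    0<0+1 : 0ℚ < 0ℚ + 1ℚ
    0<0+1 = p<p+q 0ℚ 0<1

module FirstHappening {nP nA : ℕ} (Pr : Problem nP nA) (ε : ℚ) (0≤ε : 0ℚ ≤ ε)
  (π : Plan nA) (τ₀ : ℚ) (τs : List ℚ) (htps : IsHtps π (τ₀ ∷ τs))
  (valid : Valid Pr ε π (τ₀ ∷ τs)) (nso : NoSelfOverlap π)
  (M : ℕ → Subset nP) (states : ValidStateSeq Pr π (τ₀ ∷ τs) M) (M₀≡I : M 0 ≡ Problem.init Pr)
  where

  open Problem Pr
  open Encoding Pr ε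
  open Encoded Pr ε
  open Network Pr ε
  open Valid valid using (durs; mutexSep)

  Snap : Set
  Snap = SnapId nA

  H₀ : Pred Snap 0ℓ
  H₀ h = InH π τ₀ h

  Running : Fin nA → Set
  Running a = RunningAfter π a τ₀

  pres⊆M₀ : ∀ {h} → H₀ h → ∀ {p} → p ∈ SnapAction.pres (snap Pr h) → p ∈ M 0
  pres⊆M₀ {h} at = proj₁ (states 0 τ₀ refl) h at

  ∈M₁⇔ : ∀ p → (p ∈ M 1) ⇔ ((p ∈ M 0 × ¬ InDels Pr π τ₀ p) ⊎ InAdds Pr π τ₀ p)
  ∈M₁⇔ = proj₁ (proj₂ (states 0 τ₀ refl))

  H₀-no-mutex : ∀ {h h'} → H₀ h → H₀ h' → h ≢ h' → ¬ mutex (snap Pr h) (snap Pr h')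
  H₀-no-mutex at at' h≢h' m =
    <-irrefl (sym (cong ∣_∣ (+-inverseʳ τ₀))) (proj₁ (mutexSep τ₀ τ₀ _ _ at at' h≢h' m))

  happening∈htps : ∀ {t h} → InH π t h → t ∈ˡ τ₀ ∷ τs
  happening∈htps {t} {h} at = Equivalence.from (proj₂ htps t) (h , at)

  happening-≥-τ₀ : ∀ {t h} → InH π t h → τ₀ ≤ t
  happening-≥-τ₀ = sorted-head-≤ (proj₁ htps) ∘ happening∈htps

  start≤end : ∀ {α s d} → (α , s , d) ∈ˡ π → s ≤ s + d
  start≤end {α} {s} {d} e∈ = p≤p+q s (proj₂ (durs α s d e∈))

  running-entry : ∀ {a} → Running a → ∃[ d ] ((a , τ₀ , d) ∈ˡ π × τ₀ < τ₀ + d)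
  running-entry ra with find ra
  ... | (_ , s , d) , e∈ , refl , s≤τ₀ , ongoing
    with ≤-antisym s≤τ₀ (happening-≥-τ₀ (start-happens e∈))
  ...   | refl = d , e∈ , ≰⇒> ongoing

  running-starts : ∀ {a} → Running a → H₀ (a , start)
  running-starts ra = start-happens (proj₁ (proj₂ (running-entry ra)))

  running-not-ending : ∀ {a} → Running a → ¬ H₀ (a , end)
  running-not-ending ra (_ , _ , _ , _  , inj₁ (() , _))
  running-not-ending ra (_ , s , d , e∈ , inj₂ (refl , τ₀≡s+d)) with running-entry ra
  ... | d' , e'∈ , τ₀<τ₀+d' =
    no-self-overlap-∈ nso e∈ e'∈ distinct s≤τ₀ (≤-reflexive τ₀≡s+d)
    where
    s≤τ₀ : s ≤ τ₀
    s≤τ₀ = ≤-trans (start≤end e∈) (≤-reflexive (sym τ₀≡s+d))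
    distinct : (s , d) ≢ (τ₀ , d')
    distinct refl = <-irrefl τ₀≡s+d τ₀<τ₀+d'

  ending-started : ∀ {a} → H₀ (a , end) → H₀ (a , start)
  ending-started (_ , _ , _ , _  , inj₁ (() , _))
  ending-started (_ , s , d , e∈ , inj₂ (refl , τ₀≡s+d))
    with ≤-antisym (happening-≥-τ₀ (start-happens e∈))
                   (≤-trans (start≤end e∈) (≤-reflexive (sym τ₀≡s+d)))
  ... | refl = start-happens e∈

  idle-started-ends : ∀ {a} → ¬ Running a → H₀ (a , start) → H₀ (a , end) × dur-c-sat (act a) 0ℚ
  idle-started-ends idle (_ , _ , _ , _  , inj₂ (() , _))
  idle-started-ends idle (α , _ , d , e∈ , inj₁ (refl , refl)) =
    ended , subst (dur-c-sat (act α)) d≡0 (proj₁ (durs α τ₀ d e∈))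
    where
    τ₀+d≤τ₀ : τ₀ + d ≤ τ₀
    τ₀+d≤τ₀ = decidable-stable (τ₀ + d ≤? τ₀) λ ongoing → idle (lose e∈ (refl , ≤-refl , ongoing))
    τ₀+d≡τ₀ : τ₀ + d ≡ τ₀
    τ₀+d≡τ₀ = ≤-antisym τ₀+d≤τ₀ (start≤end e∈)
    d≡0 : d ≡ 0ℚ
    d≡0 = identityʳ-unique τ₀ d τ₀+d≡τ₀
    ended : H₀ (α , end)
    ended = subst (λ t → InH π t (α , end)) τ₀+d≡τ₀ (end-happens e∈)

  running-invariants-hold : ∀ {a} → Running a → ∀ {p} → p ∈ DurAction.overAll (act a) → p ∈ M 1
  running-invariants-hold {a} ra {p} p∈ with running-entry ra
  ... | d , e∈ , τ₀<end with sorted-next-≤ (proj₁ htps) (happening∈htps (end-happens e∈)) τ₀<end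
  ...   | τ₁ , τ₁-next , τ₀<τ₁ , τ₁≤end =
    proj₂ (proj₂ (states 1 τ₁ τ₁-next)) p (a , τ₀ , d , e∈ , τ₀<τ₁ , τ₁≤end , p∈)

  adds⊆M₁ : ∀ {h} → H₀ h → ∀ {p} → p ∈ SnapAction.adds (snap Pr h) → p ∈ M 1
  adds⊆M₁ {h} at {p} added = Equivalence.from (∈M₁⇔ p) (inj₂ (h , at , added))

  deleted-not-M₁ : ∀ {h p} → H₀ h →
                   p ∈ SnapAction.dels (snap Pr h) → p ∉ SnapAction.adds (snap Pr h) → p ∉ M 1
  deleted-not-M₁ {h} {p} at deleted not-added p∈ with Equivalence.to (∈M₁⇔ p) p∈
  ... | inj₁ (_ , not-deleted) = not-deleted (h , at , deleted)
  ... | inj₂ (h' , at' , added) with h' ≟ᶜ h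
  ...   | yes refl = not-added added
  ...   | no h'≢h  = H₀-no-mutex at' at h'≢h (inj₂ (p , x∈p∩q⁺ (added , deleted)))

  Touches : Snap → Fin nP → Set
  Touches h p = p ∈ SnapAction.adds (snap Pr h) ⊎ p ∈ SnapAction.dels (snap Pr h)

  TouchedBy : Pred Snap 0ℓ → Fin nP → Set
  TouchedBy E p = ∃[ h ] (E h × Touches h p)

  untouched-M₀⇔M₁ : ∀ {p} → ¬ TouchedBy H₀ p → (p ∈ M 0 ⇔ p ∈ M 1)
  untouched-M₀⇔M₁ {p} untouched = mk⇔
    (λ p∈ → Equivalence.from (∈M₁⇔ p)
              (inj₁ (p∈ , λ (h , at , deleted) → untouched (h , at , inj₂ deleted))))
    (λ p∈ → [ proj₁ , (λ (h , at , added) → ⊥-elim (untouched (h , at , inj₁ added))) ]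
              (Equivalence.to (∈M₁⇔ p) p∈))

  δ : ℚ
  δ = (τ₀ ⊔ ε) + 1ℚ

  ε<δ : ε < δ
  ε<δ = ≤-<-trans (p≤q⊔p τ₀ ε) (p<p+q _ 0<1)

  0<δ : 0ℚ < δ
  0<δ = ≤-<-trans 0≤ε ε<δ

  τ₀<δ : τ₀ < δ
  τ₀<δ = ≤-<-trans (p≤p⊔q τ₀ ε) (p<p+q _ 0<1)

  0<δ-τ₀ : 0ℚ < - τ₀ + δ
  0<δ-τ₀ = subst (_< - τ₀ + δ) (+-inverseˡ τ₀) (+-monoʳ-< (- τ₀) τ₀<δ)

  record VpReflects (E : Pred Snap 0ℓ) (v : Var nP → ℤ) : Set where
    field
      touched   : ∀ {p} → TouchedBy E p → Indicates (v (vp p)) (M 1) p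
      untouched : ∀ {p} → ¬ TouchedBy E p → Indicates (v (vp p)) (M 0) p

  record ClocksReflect (E : Pred Snap 0ℓ) (c : Snap → ℚ) : Set where
    field
      fired   : ∀ {h} → E h → c h ≡ 0ℚ
      unfired : ∀ {h} → ¬ E h → c h ≡ δ

  VpReflects-resp : ∀ {E E' v} → E ≐ E' → VpReflects E v → VpReflects E' v
  VpReflects-resp (E⊆E' , E'⊆E) reflects = record
    { touched   = λ (h , e' , t) → touched (h , E'⊆E e' , t)
    ; untouched = λ ¬t → untouched (λ (h , e , t) → ¬t (h , E⊆E' e , t)) }
    where open VpReflects reflects

  ClocksReflect-resp : ∀ {E E' c} → E ≐ E' → ClocksReflect E c → ClocksReflect E' c
  ClocksReflect-resp (E⊆E' , E'⊆E) clocks = record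
    { fired = fired ∘ E'⊆E ; unfired = λ ¬e' → unfired (¬e' ∘ E⊆E') }
    where open ClocksReflect clocks

  fresh-not-mutex : ∀ {E : Pred Snap 0ℓ} {h h'} → E ⊆ H₀ → H₀ h → ¬ E h → E h' →
                    ¬ mutex (snap Pr h) (snap Pr h')
  fresh-not-mutex {h = h} {h'} E⊆H₀ at fresh e' with h ≟ᶜ h'
  ... | yes refl   = ⊥-elim (fresh e')
  ... | no h≢h' = H₀-no-mutex at (E⊆H₀ e') h≢h'

  pre-sat-fresh : ∀ {E v h} → E ⊆ H₀ → H₀ h → ¬ E h → VpReflects E v → pre-sat h v
  pre-sat-fresh E⊆H₀ at fresh reflects p p∈pres =
    proj₁ (VpReflects.untouched reflects untouched) (pres⊆M₀ at p∈pres)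
    where
    untouched : ¬ TouchedBy _ p
    untouched (h' , e' , touches) =
      fresh-not-mutex E⊆H₀ at fresh e' (inj₁ (p , x∈p∩q⁺ (p∈pres , x∈p∪q⁺ touches)))

  mutex-guards-fresh : ∀ {E c h} → E ⊆ H₀ → H₀ h → ¬ E h → ClocksReflect E c → mutex-guards h c
  mutex-guards-fresh E⊆H₀ at fresh clocks h' m =
    subst (λ t → 0ℚ < t × ε ≤ t)
          (sym (ClocksReflect.unfired clocks (λ e' → fresh-not-mutex E⊆H₀ at fresh e' m)))
          (0<δ , <⇒≤ ε<δ)

  VpReflects-fire : ∀ {E v h} z → H₀ h → VpReflects E v →
                    VpReflects (E ∪ ｛ h ｝) (prop-effs h z v)
  VpReflects-fire {E} {v} {h} z at reflects = record
    { touched = λ {p} → proj₁ (fire-at p) ; untouched = λ {p} → proj₂ (fire-at p) }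
    where
    open VpReflects reflects
    v' : Var nP → ℤ
    v' = prop-effs h z v
    fire-at : ∀ p → (TouchedBy (E ∪ ｛ h ｝) p → Indicates (v' (vp p)) (M 1) p)
                  × (¬ TouchedBy (E ∪ ｛ h ｝) p → Indicates (v' (vp p)) (M 0) p)
    fire-at p with p ∈? SnapAction.adds (snap Pr h) | p ∈? SnapAction.dels (snap Pr h)
    ... | yes added | _ =
        (λ _ → (λ _ → refl) , (λ p∉ → ⊥-elim (p∉ (adds⊆M₁ at added))))
      , (λ ¬t → ⊥-elim (¬t (h , inj₂ refl , inj₁ added)))
    ... | no not-added | yes deleted =
        (λ _ → (λ p∈ → ⊥-elim (deleted-not-M₁ at deleted not-added p∈)) , (λ _ → refl))
      , (λ ¬t → ⊥-elim (¬t (h , inj₂ refl , inj₂ deleted)))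
    ... | no not-added | no not-deleted =
        (λ t → touched (touched-before t))
      , (λ ¬t → untouched (λ (h' , e , t) → ¬t (h' , inj₁ e , t)))
      where
      touched-before : TouchedBy (E ∪ ｛ h ｝) p → TouchedBy E p
      touched-before (h' , inj₁ e , t)          = h' , e , t
      touched-before (_  , inj₂ refl , inj₁ a) = ⊥-elim (not-added a)
      touched-before (_  , inj₂ refl , inj₂ d) = ⊥-elim (not-deleted d)

  ClocksReflect-reset : ∀ {E c h} → ClocksReflect E c → ClocksReflect (E ∪ ｛ h ｝) (reset h c)
  ClocksReflect-reset {E} {c} {h} clocks = record
    { fired = λ {x} → proj₁ (reset-at x) ; unfired = λ {x} → proj₂ (reset-at x) }
    where
    open ClocksReflect clocks
    reset-at : ∀ x → ((E ∪ ｛ h ｝) x → reset h c x ≡ 0ℚ)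
                   × (¬ (E ∪ ｛ h ｝) x → reset h c x ≡ δ)
    reset-at x with x ≟ᶜ h
    ... | yes refl = (λ _ → refl) , (λ ¬e → ⊥-elim (¬e (inj₂ refl)))
    ... | no x≢h  = [ fired , (λ h≡x → ⊥-elim (x≢h (sym h≡x))) ]
                  , (λ ¬e → unfired (¬e ∘ inj₁))

  Executed : List (Fin nA) → Pred Snap 0ℓ
  Executed pending h = proj₁ h ∉ˡ pending × H₀ h

  executed-next : ∀ {x xs} {E : Pred Snap 0ℓ} → x ∉ˡ xs → Executed (x ∷ xs) ⊆ E →
                  (∀ {s} → H₀ (x , s) → E (x , s)) → E ⊆ Executed xs → E ≐ Executed xs
  executed-next {x} {xs} {E} x∉ old new sound = sound , complete
    where
    complete : Executed xs ⊆ E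
    complete {a , s} (a∉ , at) with a ≟ᶠ x
    ... | yes refl = new at
    ... | no a≢x  = old ((λ { (here a≡x) → a≢x a≡x ; (there a∈) → a∉ a∈ }) , at)

  executed-shrink : ∀ {x xs} → Executed (x ∷ xs) ⊆ Executed xs
  executed-shrink (x∉ , at) = x∉ ∘ there , at

  whenRunning : ALoc → Fin nA → ALoc
  whenRunning l a = if does (running-after? π a τ₀) then l else inactive

  whenRunning-yes : ∀ {l a} → Running a → whenRunning l a ≡ l
  whenRunning-yes {a = a} ra with running-after? π a τ₀
  ... | yes _   = refl
  ... | no idle = ⊥-elim (idle ra)

  whenRunning-no : ∀ {l a} → ¬ Running a → whenRunning l a ≡ inactive
  whenRunning-no {a = a} idle with running-after? π a τ₀
  ... | yes ra = ⊥-elim (idle ra)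
  ... | no _   = refl

  record Phase1 (pending : List (Fin nA)) (C : Conf) : Set where
    field
      located        : Located (λ _ → inactive) (whenRunning starting) pending (Config.L C)
      ps≡1           : Config.v C ps ≡ + 1
      lp≡0           : ∀ p → Config.v C (lp p) ≡ + 0
      vp-reflects    : VpReflects (Executed pending) (Config.v C)
      clocks-reflect : ClocksReflect (Executed pending) (Config.c C)

  phase1-start : Phase1 (allFin nA) ⟨ startLocs , startVars , (λ _ → 0ℚ + δ) ⟩
  phase1-start = record
    { located        = record { pending-at = λ _ → refl
                              ; done-at    = λ {a} a∉ → ⊥-elim (a∉ (∈-allFin a)) }
    ; ps≡1           = refl
    ; lp≡0           = λ _ → refl
    ; vp-reflects    = record
      { touched   = λ (_ , (a∉ , _) , _) → ⊥-elim (a∉ (∈-allFin _))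
      ; untouched = λ {p} _ → subst (λ X → Indicates (startVars (vp p)) X p) (sym M₀≡I)
                                    (startVars-indicate-init p) }
    ; clocks-reflect = record
      { fired = λ (a∉ , _) → ⊥-elim (a∉ (∈-allFin _)) ; unfired = λ _ → +-identityˡ δ } }

  start-running : ∀ {xs x C} → Running x → x ∉ˡ xs → Phase1 (x ∷ xs) C →
                  ∃[ C' ] (Run net C C' × Phase1 xs C')
  start-running {xs} {x} {⟨ L , v , c ⟩} ra x∉ inv = _ , fire ◅ [] , record
    { located        = located-step x∉ located ([]≔-other L x starting)
                                    (trans ([]≔-self L x starting) (sym (whenRunning-yes ra)))
    ; ps≡1           = ps≡1
    ; lp≡0           = lp≡0
    ; vp-reflects    = VpReflects-resp executed (VpReflects-fire (+ 1) started vp-reflects)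
    ; clocks-reflect = ClocksReflect-resp executed (ClocksReflect-reset clocks-reflect) }
    where
    open Phase1 inv
    started : H₀ (x , start)
    started = running-starts ra
    fresh : ¬ Executed (x ∷ xs) (x , start)
    fresh (x∉x∷xs , _) = x∉x∷xs (here refl)
    executed : Executed (x ∷ xs) ∪ ｛ x , start ｝ ≐ Executed xs
    executed = executed-next x∉ inj₁
                             (λ { {start} _ → inj₂ refl ; {end} ended → ⊥-elim (running-not-ending ra ended) })
                             [ executed-shrink , (λ { refl → x∉ , started }) ]
    fire : Step net ⟨ L , v , c ⟩
                    ⟨ L [ x ]≔ starting , prop-effs (x , start) (+ 1) v , reset (x , start) c ⟩
    fire = actionStep x se (sym (Located.pending-at located (here refl)))
                      (ps≡1 , pre-sat-fresh proj₂ started fresh vp-reflects , (λ p _ _ → lp≡0 p))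
                      (mutex-guards-fresh proj₂ started fresh clocks-reflect)

  stay-idle : ∀ {xs x C} → ¬ Running x → ¬ H₀ (x , start) → x ∉ˡ xs → Phase1 (x ∷ xs) C → Phase1 xs C
  stay-idle {xs} {x} idle unstarted x∉ inv = record
    { located        = located-step x∉ located (λ _ _ → refl)
                                    (trans (Located.pending-at located (here refl)) (sym (whenRunning-no idle)))
    ; ps≡1           = ps≡1
    ; lp≡0           = lp≡0
    ; vp-reflects    = VpReflects-resp executed vp-reflects
    ; clocks-reflect = ClocksReflect-resp executed clocks-reflect }
    where
    open Phase1 inv
    executed : Executed (x ∷ xs) ≐ Executed xs
    executed = executed-next x∉ (λ e → e)
                             (λ { {start} started → ⊥-elim (unstarted started)
                                ; {end} ended → ⊥-elim (unstarted (ending-started ended)) })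
                             executed-shrink

  fire-instantaneous : ∀ {xs x C} → ¬ Running x → H₀ (x , start) → x ∉ˡ xs → Phase1 (x ∷ xs) C →
                       ∃[ C' ] (Run net C C' × Phase1 xs C')
  fire-instantaneous {xs} {x} {⟨ L , v , c ⟩} idle started x∉ inv = _ , run , record
    { located        = located-step x∉ located unmoved
                                    (trans ([]≔-self L₂ x inactive) (sym (whenRunning-no idle)))
    ; ps≡1           = ps≡1
    ; lp≡0           = lp≡0
    ; vp-reflects    = VpReflects-resp executed (VpReflects-fire (ℤ.- (+ 1)) ended vp-reflects₁)
    ; clocks-reflect = ClocksReflect-resp executed clocks-reflect₂ }
    where
    open Phase1 inv
    x⊢ x⊣ : Snap
    x⊢ = x , start
    x⊣ = x , end
    ended : H₀ x⊣
    ended = proj₁ (idle-started-ends idle started)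
    E₀ E₁ E₂ : Pred Snap 0ℓ
    E₀ = Executed (x ∷ xs)
    E₁ = E₀ ∪ ｛ x⊢ ｝
    E₂ = E₁ ∪ ｛ x⊣ ｝
    fresh₀ : ¬ E₀ x⊢
    fresh₀ (x∉x∷xs , _) = x∉x∷xs (here refl)
    fresh₁ : ¬ E₁ x⊣
    fresh₁ (inj₁ (x∉x∷xs , _)) = x∉x∷xs (here refl)
    fresh₁ (inj₂ ())
    E₁⊆H₀ : E₁ ⊆ H₀
    E₁⊆H₀ (inj₁ (_ , at)) = at
    E₁⊆H₀ (inj₂ refl)     = started
    vp-reflects₁ : VpReflects E₁ (prop-effs x⊢ (+ 1) v)
    vp-reflects₁ = VpReflects-fire (+ 1) started vp-reflects
    clocks-reflect₁ : ClocksReflect E₁ (reset x⊢ c)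
    clocks-reflect₁ = ClocksReflect-reset clocks-reflect
    clocks-reflect₂ : ClocksReflect E₂ (reset x⊣ (reset x⊢ c))
    clocks-reflect₂ = ClocksReflect-reset clocks-reflect₁
    executed : E₂ ≐ Executed xs
    executed = executed-next x∉ (inj₁ ∘ inj₁)
                             (λ { {start} _ → inj₁ (inj₂ refl) ; {end} _ → inj₂ refl })
                             [ [ executed-shrink , (λ { refl → x∉ , started }) ]
                             , (λ { refl → x∉ , ended }) ]
    L₁ L₂ : Locs
    L₁ = L [ x ]≔ starting
    L₂ = L₁ [ x ]≔ ending
    unmoved : ∀ a → a ≢ x → (L₂ [ x ]≔ inactive) (suc a) ≡ L (suc a)
    unmoved a a≢x = trans ([]≔-other L₂ x inactive a a≢x)
                          (trans ([]≔-other L₁ x ending a a≢x) ([]≔-other L x starting a a≢x))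
    run : Run net ⟨ L , v , c ⟩ ⟨ L₂ [ x ]≔ inactive
                                , prop-effs x⊣ (ℤ.- (+ 1)) (prop-effs x⊢ (+ 1) v)
                                , reset x⊣ (reset x⊢ c) ⟩
    run = actionStep x se (sym (Located.pending-at located (here refl)))
                     (ps≡1 , pre-sat-fresh proj₂ started fresh₀ vp-reflects , (λ p _ _ → lp≡0 p))
                     (mutex-guards-fresh proj₂ started fresh₀ clocks-reflect)
        ◅ actionStep x ie (sym ([]≔-self L x starting)) (ps≡1 , tt)
                     ( mutex-guards-fresh E₁⊆H₀ ended fresh₁ clocks-reflect₁
                     , subst (dur-c-sat (act x)) (sym (ClocksReflect.fired clocks-reflect₁ (inj₂ refl)))
                             (proj₂ (idle-started-ends idle started)))
        ◅ actionStep x ee' (sym ([]≔-self L₁ x ending))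
                     (ps≡1 , pre-sat-fresh E₁⊆H₀ ended fresh₁ vp-reflects₁ , (λ p _ _ → lp≡0 p)) tt
        ◅ []

  phase1-step : ∀ {x xs C} → x ∉ˡ xs → Phase1 (x ∷ xs) C → ∃[ C' ] (Run net C C' × Phase1 xs C')
  phase1-step {x} x∉ inv with running-after? π x τ₀ | InH? π τ₀ (x , start)
  ... | yes ra   | _             = start-running ra x∉ inv
  ... | no idle  | yes started   = fire-instantaneous idle started x∉ inv
  ... | no idle  | no unstarted = _ , [] , stay-idle idle unstarted x∉ inv

  pending-count : Fin nP → List (Fin nA) → ℕ
  pending-count p =
    length ∘ filter (λ a → (p ∈? DurAction.overAll (act a)) ×-dec running-after? π a τ₀)

  pending-count-running : ∀ {x} → Running x → ∀ (v : Var nP → ℤ) p xs →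
    lp-shift x (+ 1) v (lp p) ℤ.+ + pending-count p xs ≡ v (lp p) ℤ.+ + pending-count p (x ∷ xs)
  pending-count-running {x} ra v p xs with p ∈? DurAction.overAll (act x) | running-after? π x τ₀
  ... | _     | no idle = ⊥-elim (idle ra)
  ... | yes _ | yes _   = ℤP.+-assoc (v (lp p)) (+ 1) _
  ... | no _  | yes _   = refl

  pending-count-idle : ∀ {x} → ¬ Running x → ∀ p xs → pending-count p (x ∷ xs) ≡ pending-count p xs
  pending-count-idle {x} idle p xs with p ∈? DurAction.overAll (act x) | running-after? π x τ₀
  ... | _     | yes ra = ⊥-elim (idle ra)
  ... | yes _ | no _   = refl
  ... | no _  | no _   = refl

  record Phase2 (pending : List (Fin nA)) (C : Conf) : Set where
    field
      located        : Located (whenRunning starting) (whenRunning running) pending (Config.L C)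
      ps≡1           : Config.v C ps ≡ + 1
      lp-pending     : ∀ p → Config.v C (lp p) ℤ.+ + pending-count p pending ≡ + lp-count π τ₀ p
      vp-indicate    : ∀ p → Indicates (Config.v C (vp p)) (M 1) p
      clocks-reflect : ClocksReflect H₀ (Config.c C)

  -- TouchedBy H₀ p is not known to be decidable, but Indicates is stable under double negation.
  vp-indicate-M₁ : ∀ {v} → VpReflects H₀ v → ∀ p → Indicates (v (vp p)) (M 1) p
  vp-indicate-M₁ reflects p = indicates-stable λ ¬indicates → ¬¬-excluded-middle λ
    { (yes touched)   → ¬indicates (VpReflects.touched reflects touched)
    ; (no untouched) → ¬indicates (indicates-resp (untouched-M₀⇔M₁ untouched)
                                                   (VpReflects.untouched reflects untouched)) }

  phase1-complete : ∀ {C} → Phase1 [] C → Phase2 (allFin nA) C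
  phase1-complete inv = record
    { located        = record { pending-at = λ _ → Located.done-at located λ ()
                              ; done-at    = λ {a} a∉ → ⊥-elim (a∉ (∈-allFin a)) }
    ; ps≡1           = ps≡1
    ; lp-pending     = λ p → cong (ℤ._+ _) (lp≡0 p)
    ; vp-indicate    = vp-indicate-M₁ (VpReflects-resp executed vp-reflects)
    ; clocks-reflect = ClocksReflect-resp executed clocks-reflect }
    where
    open Phase1 inv
    executed : Executed [] ≐ H₀
    executed = proj₂ , (λ at → (λ ()) , at)

  register-running : ∀ {xs x C} → Running x → x ∉ˡ xs → Phase2 (x ∷ xs) C →
                     ∃[ C' ] (Run net C C' × Phase2 xs C')
  register-running {xs} {x} {⟨ L , v , c ⟩} ra x∉ inv = _ , register ◅ [] , record
    { located        = located-step x∉ located ([]≔-other L x running)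
                                    (trans ([]≔-self L x running) (sym (whenRunning-yes ra)))
    ; ps≡1           = ps≡1
    ; lp-pending     = λ p → trans (pending-count-running ra v p xs) (lp-pending p)
    ; vp-indicate    = vp-indicate
    ; clocks-reflect = clocks-reflect }
    where
    open Phase2 inv
    register : Step net ⟨ L , v , c ⟩ ⟨ L [ x ]≔ running , lp-shift x (+ 1) v , c ⟩
    register = actionStep x se' (sym (trans (Located.pending-at located (here refl)) (whenRunning-yes ra)))
                          (ps≡1 , λ p p∈ → proj₁ (vp-indicate p) (running-invariants-hold ra p∈)) tt

  skip-idle : ∀ {xs x C} → ¬ Running x → x ∉ˡ xs → Phase2 (x ∷ xs) C → Phase2 xs C
  skip-idle {xs} {x} {⟨ L , v , c ⟩} idle x∉ inv = record
    { located        = located-step x∉ located (λ _ _ → refl)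
                         (trans (Located.pending-at located (here refl))
                                (trans (whenRunning-no idle) (sym (whenRunning-no idle))))
    ; ps≡1           = ps≡1
    ; lp-pending     = λ p → trans (cong (λ n → v (lp p) ℤ.+ + n) (sym (pending-count-idle idle p xs)))
                                   (lp-pending p)
    ; vp-indicate    = vp-indicate
    ; clocks-reflect = clocks-reflect }
    where open Phase2 inv

  phase2-step : ∀ {x xs C} → x ∉ˡ xs → Phase2 (x ∷ xs) C → ∃[ C' ] (Run net C C' × Phase2 xs C')
  phase2-step {x} x∉ inv with running-after? π x τ₀
  ... | yes ra  = register-running ra x∉ inv
  ... | no idle = _ , [] , skip-idle idle x∉ inv

  time-since-τ₀ : ∀ {c} → ClocksReflect H₀ c → ∀ h → TimeSinceAfter π h τ₀ (c h)
  time-since-τ₀ clocks h with InH? π τ₀ h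
  ... | yes at = inj₁ (τ₀ , at , ≤-refl , (λ _ _ s≤τ₀ → s≤τ₀)
                      , trans (ClocksReflect.fired clocks at) (sym (+-inverseʳ τ₀)))
  ... | no ¬at = inj₂ ( (λ s at' s≤τ₀ →
                           ¬at (subst (λ t → InH π t h) (≤-antisym s≤τ₀ (happening-≥-τ₀ at')) at'))
                      , - τ₀ + δ , 0<δ-τ₀
                      , trans (ClocksReflect.unfired clocks ¬at) (sym (\\-leftDividesˡ τ₀ δ)))

  phase2-complete : ∀ {C} → Phase2 [] C → EncodesAfter π (τ₀ ∷ τs) M 0 C
  phase2-complete {⟨ L , v , c ⟩} inv =
      τ₀ , refl
    , (λ a → (λ ra → trans (done-at a) (whenRunning-yes ra))
           , (λ idle → trans (done-at a) (whenRunning-no idle))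
           , time-since-τ₀ clocks-reflect (a , start) , time-since-τ₀ clocks-reflect (a , end))
    , vp-indicate
    , (λ p → trans (sym (ℤP.+-identityʳ (v (lp p)))) (lp-pending p))
    where
    open Phase2 inv
    done-at : ∀ a → L (suc a) ≡ whenRunning running a
    done-at a = Located.done-at located λ ()

  encoded-after-first : ∃[ C₀ ] (Run net (initConfig net) C₀ × EncodesAfter π (τ₀ ∷ τs) M 0 C₀)
  encoded-after-first with iterate-over-Unique Phase1 phase1-step (allFin⁺ nA) phase1-start
  ... | _ , run₁ , inv₁ with iterate-over-Unique Phase2 phase2-step (allFin⁺ nA) (phase1-complete inv₁)
  ...   | C₀ , run₂ , inv₂ =
    C₀ , start-run δ (<⇒≤ 0<δ) ◅◅ run₁ ◅◅ run₂ , phase2-complete inv₂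

lemma2 : ∀ {nP nA : ℕ} (Pr : Problem nP nA) (ε : ℚ) → 0ℚ ≤ ε →
         (π : Plan nA) (τs : List ℚ) → IsHtps π τs →
         Valid Pr ε π τs → NoSelfOverlap π →
         (M : ℕ → Subset nP) → ValidStateSeq Pr π τs M → M 0 ≡ Problem.init Pr →
         ∃[ C₀ ] (Run (Encoding.net Pr ε) (initConfig (Encoding.net Pr ε)) C₀
                  × Encoded.EncodesAfter Pr ε π τs M 0 C₀)
lemma2 Pr ε _ π [] _ _ _ M _ _ = Network.encoded-without-happenings Pr ε π M
lemma2 Pr ε 0≤ε π (τ₀ ∷ τs) htps valid nso M states M₀≡I =
  FirstHappening.encoded-after-first Pr ε 0≤ε π τ₀ τs htps valid nso M states M₀≡I
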